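{- Let $G=(V,E)$ be a connected graph with $n\ge 2$ vertices, $b$ an integer with $1\le b<n$, $\mathcal{D}$ a fixed rooted spanning tree of $G$ with $L$ leaves, and $\phi$ a segment assignment. In one run of the second phase (the depth-first search described below) on $\phi$, the algorithm visits at most $3^{n-L}4^L\le 4^n$ states.
   Context: For integers $i<j$, the segment $\Theta_{(i,j)}$ is $\{i(b+1)+1,\dots,j(b+1)\}\cap\{1,\dots,n\}$, considered only when nonempty; $\Theta_i:=\Theta_{(i,i+1)}$ are base segments. For a position $p$, $\mathtt{segment}(p)=\lceil p/(b+1)\rceil$, $\mathtt{color}(p)=((p-1)\bmod(b+1))+1$; the color order sorts positions $1,\dots,n$ lexicographically by $(\mathtt{color}(p),\mathtt{segment}(p))$. In $\mathcal{D}$, a leaf is a non-root vertex with no children; other vertices (including the root) are inner. A segment assignment is a function $\phi$ assigning a segment to every vertex such that: (1) every leaf gets a segment $\Theta_{(i,i+4)}$; (2) every inner vertex gets a segment $\Theta_{(i,i+2)}$; (3) if $u$ is the parent of an inner vertex $v$ in $\mathcal{D}$, $\phi(u)=\Theta_{(i,i+2)}$, $\phi(v)=\Theta_{(j,j+2)}$, then $|i-j|=1$; (4) if $v$ is a leaf with parent $u$ and $\phi(u)=\Theta_{(i,i+2)}$, then $\phi(v)=\Theta_{(i-1,i+3)}$. A state candidate is a partial function $s$ from $V$ to $\{\Theta_i: 0\le i<\lceil n/(b+1)\rceil\}$ such that $s(v)\subseteq\phi(v)$ whenever $s(v)$ is defined. A state is a state candidate $s$ such that: (1) the vertices of $\mathrm{dom}(s)$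 can be bijectively assigned to the first $|\mathrm{dom}(s)|$ positions in the color order so that each $v$ gets a position in $s(v)$; (2) for every edge $uv\in E$: either both $s(u),s(v)$ are undefined; or exactly one is defined, say $s(v)=\Theta_i$ and $s(u)$ undefined, and then, writing $\phi(u)=\Theta_{(k,l)}$, we have $k\le i$; or both are defined, $s(v)=\Theta_i$, $s(u)=\Theta_k$, and $|i-k|\le1$. A state $s'$ is an extension of a state $s$ if there is a vertex $v$ with $s(v)$ undefined, $\mathrm{dom}(s')=\mathrm{dom}(s)\cup\{v\}$, $s'$ agrees with $s$ on $\mathrm{dom}(s)$, and for every edge $uv\in E$ with $s'(u)=\Theta_k$, $s'(v)=\Theta_i$ we have $k-1\le i\le k$. The second phase on $\phi$ is a depth-first search over states (each state visited at most once) starting from the empty state; from a state $s$ with $|\mathrm{dom}(s)|=k<n$ it moves to every extension $s'$ of $s$ obtained by defining $s'$ at some vertex undefined in $s$ as the base segment containing the $(k+1)$-th position in the color order; it stops when a state with domain $V$ is reached or the search is exhausted. -}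

module Defs where

open import Data.Nat as ℕ using (ℕ; zero; suc; _<ᵇ_; _≡ᵇ_)
open import Data.Nat.DivMod using (_/_; _%_)
open import Data.Integer as ℤ using (ℤ; +_)
open import Data.Bool using (Bool; true; false; _∧_; _∨_; not; T; if_then_else_)
open import Data.Fin using (Fin)
open import Data.Fin.Properties using () renaming (_≟_ to _≟ᶠ_)
open import Data.List using (List; length; filterᵇ; map; upTo; allFin)
open import Data.Bool.ListAction using (any)
open import Data.Vec using (Vec; lookup; replicate)
open import Data.Maybe using (Maybe; just; nothing; is-just)
open import Data.Product using (Σ; ∃; ∃-syntax; _×_; _,_)
open import Data.Unit using (⊤)
open import Relation.Nullary using (¬_)
open import Relation.Nullary.Decidable using (⌊_⌋)
open import Relation.Binary.PropositionalEquality using (_≡_; _≢_)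
open import Relation.Binary.Construct.Closure.ReflexiveTransitive using (Star)

-- ceiling division ⌈ p / (b+1) ⌉
segment : (b p : ℕ) → ℕ
segment b p = (p ℕ.+ b) / suc b

color : (b p : ℕ) → ℕ
color b p = suc ((p ℕ.∸ 1) % suc b)

precedes : (b q p : ℕ) → Bool
precedes b q p = (color b q <ᵇ color b p)
               ∨ ((color b q ≡ᵇ color b p) ∧ (segment b q <ᵇ segment b p))

positions : ℕ → List ℕ
positions n = map suc (upTo n)

IsPos : (n p : ℕ) → Set
IsPos n p = 1 ℕ.≤ p × p ℕ.≤ n

-- rank n b p = number of positions before p in the colour order,
-- i.e. p is the (rank+1)-th position of the colour order
rank : (n b p : ℕ) → ℕ
rank n b p = length (filterᵇ (λ q → precedes b q p) (positions n))

InSeg : (n b : ℕ) → (i j : ℤ) → (p : ℕ) → Set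
InSeg n b i j p = IsPos n p
                × (i ℤ.* + suc b ℤ.+ + 1 ℤ.≤ + p)
                × (+ p ℤ.≤ j ℤ.* + suc b)

InBase : (n b i p : ℕ) → Set
InBase n b i p = InSeg n b (+ i) (+ suc i) p

numBase : (n b : ℕ) → ℕ
numBase n b = segment b n

baseOf : (b p : ℕ) → ℕ
baseOf b p = (p ℕ.∸ 1) / suc b

record Graph (n : ℕ) : Set₁ where
  field
    Adj    : Fin n → Fin n → Set
    sym    : ∀ {u v} → Adj u v → Adj v u
    irrefl : ∀ {u} → ¬ Adj u u
open Graph public

Connected : ∀ {n} → Graph n → Set
Connected G = ∀ u v → Star (Adj G) u v

iter : ∀ {A : Set} → (A → A) → ℕ → A → A
iter f zero    x = x
iter f (suc k) x = f (iter f k x)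

-- A rooted spanning tree 𝒟 of G, given by its root and parent map:
-- tree edges are {v , parent v} for v ≠ root (all edges of G), and every
-- vertex reaches the root by following parents.
record RootedSpanningTree {n : ℕ} (G : Graph n) : Set where
  field
    root        : Fin n
    parent      : Fin n → Fin n
    parent-root : parent root ≡ root
    parent-adj  : ∀ v → v ≢ root → Adj G v (parent v)
    reaches     : ∀ v → ∃[ k ] iter parent k v ≡ root
open RootedSpanningTree public

isChildOf : ∀ {n} {G : Graph n} → RootedSpanningTree G → Fin n → Fin n → Bool
isChildOf D u v = not ⌊ u ≟ᶠ root D ⌋ ∧ ⌊ parent D u ≟ᶠ v ⌋

isLeaf : ∀ {n} {G : Graph n} → RootedSpanningTree G → Fin n → Bool
isLeaf {n} D v = not ⌊ v ≟ᶠ root D ⌋ ∧ not (any (λ u → isChildOf D u v) (allFin n))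

numLeaves : ∀ {n} {G : Graph n} → RootedSpanningTree G → ℕ
numLeaves {n} D = length (filterᵇ (isLeaf D) (allFin n))

-- Segment assignments.  φ is represented by ι : V → ℤ, where
-- φ(v) = Θ_(ι v , ι v + 4) for a leaf v and φ(v) = Θ_(ι v , ι v + 2)
-- for an inner vertex v.

width : ∀ {n} {G : Graph n} → RootedSpanningTree G → Fin n → ℤ
width D v = if isLeaf D v then + 4 else + 2

InPhi : ∀ {n} (b : ℕ) {G : Graph n} → RootedSpanningTree G → (Fin n → ℤ) → Fin n → ℕ → Set
InPhi {n} b D ι v p = InSeg n b (ι v) (ι v ℤ.+ width D v) p

record SegmentAssignment {n : ℕ} (b : ℕ) (G : Graph n) (D : RootedSpanningTree G)
                         (ι : Fin n → ℤ) : Set where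
  field
    leaf-seg   : ∀ v → T (isLeaf D v) → ∃[ p ] InSeg n b (ι v) (ι v ℤ.+ + 4) p
    inner-seg  : ∀ v → T (not (isLeaf D v)) → ∃[ p ] InSeg n b (ι v) (ι v ℤ.+ + 2) p
    inner-step : ∀ v → v ≢ root D → T (not (isLeaf D v)) →
                 ℤ.∣ ι (parent D v) ℤ.- ι v ∣ ≡ 1
    -- (4) leaf v with parent u, φ(u) = Θ_(i,i+2) : φ(v) = Θ_(i-1,i+3)
    leaf-step  : ∀ v → T (isLeaf D v) → ι v ≡ ι (parent D v) ℤ.- + 1

-- States.  A partial function V ⇀ {Θ_i} is a vector of Maybe ℕ
-- (just i  means  s(v) = Θ_i).

PState : ℕ → Set
PState n = Vec (Maybe ℕ) n

emptyState : ∀ n → PState n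
emptyState n = replicate n nothing

domSize : ∀ {n} → PState n → ℕ
domSize {n} s = length (filterᵇ (λ v → is-just (lookup s v)) (allFin n))

StateCandidate : ∀ {n} (b : ℕ) {G : Graph n} → RootedSpanningTree G → (Fin n → ℤ) → PState n → Set
StateCandidate {n} b D ι s =
  ∀ v i → lookup s v ≡ just i →
    i ℕ.< numBase n b × (∀ p → InBase n b i p → InPhi b D ι v p)

-- condition (1) of a state: a bijection dom(s) → first |dom s| positions
-- of the colour order, each v mapped into s(v)
Placeable : ∀ {n} (b : ℕ) → PState n → Set
Placeable {n} b s =
  Σ (Fin n → ℕ) λ f →
    (∀ v i → lookup s v ≡ just i →
       IsPos n (f v) × rank n b (f v) ℕ.< domSize s × InBase n b i (f v))
  × (∀ u v i j → lookup s u ≡ just i → lookup s v ≡ just j → f u ≡ f v → u ≡ v)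
  × (∀ p → IsPos n p → rank n b p ℕ.< domSize s →
       ∃[ v ] (∃[ i ] lookup s v ≡ just i) × f v ≡ p)

EdgeOK : ℤ → ℤ → Maybe ℕ → Maybe ℕ → Set
EdgeOK ιu ιv nothing  nothing  = ⊤
EdgeOK ιu ιv nothing  (just i) = ιu ℤ.≤ + i
EdgeOK ιu ιv (just k) nothing  = ιv ℤ.≤ + k
EdgeOK ιu ιv (just k) (just i) = ℤ.∣ + i ℤ.- + k ∣ ℕ.≤ 1

IsState : ∀ {n} (b : ℕ) (G : Graph n) → RootedSpanningTree G → (Fin n → ℤ) → PState n → Set
IsState b G D ι s =
    StateCandidate b D ι s
  × Placeable b s
  × (∀ u v → Adj G u v → EdgeOK (ι u) (ι v) (lookup s u) (lookup s v))

ExtensionAt : ∀ {n} (b : ℕ) (G : Graph n) → RootedSpanningTree G → (Fin n → ℤ) →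
              PState n → PState n → Fin n → Set
ExtensionAt b G D ι s s' v =
    IsState b G D ι s
  × IsState b G D ι s'
  × lookup s v ≡ nothing
  × (∃[ i ] lookup s' v ≡ just i)
  × (∀ w → w ≢ v → lookup s' w ≡ lookup s w)
  × (∀ u k i → Adj G u v → lookup s' u ≡ just k → lookup s' v ≡ just i →
       (+ k ℤ.- + 1 ℤ.≤ + i) × (+ i ℤ.≤ + k))

-- one move of the second phase: from s (|dom s| = k) to an extension s'
-- defined at a new vertex v as the base segment containing the
-- (k+1)-th position of the colour order
Step : ∀ {n} (b : ℕ) (G : Graph n) → RootedSpanningTree G → (Fin n → ℤ) →
       PState n → PState n → Set
Step {n} b G D ι s s' =
  ∃[ v ] ExtensionAt b G D ι s s' v
       × (∃[ p ] IsPos n p × rank n b p ≡ domSize s × lookup s' v ≡ just (baseOf b p))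

-- states that the depth-first search can ever visit: those reachable from
-- the empty state by moves
Reachable : ∀ {n} (b : ℕ) (G : Graph n) → RootedSpanningTree G → (Fin n → ℤ) → PState n → Set
Reachable {n} b G D ι s = Star (Step b G D ι) (emptyState n) s

-- A reachable state is a state candidate satisfying the edge conditions, and
-- these leave each vertex few possibilities.  For an inner vertex v, Θ_i ⊆ φ(v)
-- forces i ∈ {ι v, ι v + 1}; with "undefined" that makes 3.  For a leaf v with
-- parent u there are 4: if s(u) is undefined, the edge condition and Θ_i ⊆ φ(v)
-- force i ∈ {ι u, ι u + 1, ι u + 2}, and if s(u) = Θ_k, then |i − k| ≤ 1.
-- Since u is inner, s(u) is known from u's own digit, so the digits of s, read
-- as a mixed-radix numeral (radix 3 at inner vertices, 4 at leaves), determine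
-- s: distinct visited states get distinct numbers below 3^(n−L) 4^L.
module Submission where

open import Defs
open import Data.Nat using (ℕ; _≤_; _<_; _∸_; _*_; _^_)
open import Data.Integer using (ℤ)
open import Data.Fin using (Fin)
open import Data.Product using (_×_)
open import Data.List using (List; length)
open import Data.List.Relation.Unary.All using (All)
open import Data.List.Relation.Unary.Unique.Propositional using (Unique)

open import Data.Nat as ℕ using (zero; suc; z≤n; s≤s; _+_)
import Data.Nat.Properties as ℕ
open import Algebra.Properties.CommutativeSemigroup ℕ.*-commutativeSemigroup using (x∙yz≈y∙xz)
open import Data.Nat.DivMod using (_%_; m/n*n≤m; [m+kn]%n≡m%n; m<n⇒m%n≡m)
open import Data.Integer as ℤ using (+_; _⊖_)
import Data.Integer.Properties as ℤ
open import Data.Integer.Tactic.RingSolver using (solve-∀)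
open import Data.Bool using (Bool; true; false; T; not; _∧_; if_then_else_)
open import Data.Bool.Properties using (T?; T-∧; T-≡; ∧-zeroʳ)
open import Data.Bool.ListAction using (any)
open import Data.Maybe using (Maybe; just; nothing)
open import Data.Product using (_,_; proj₁; proj₂)
open import Data.Empty using (⊥-elim)
open import Data.Unit using (⊤; tt)
open import Data.Vec using (lookup)
open import Data.Vec.Properties using (lookup-replicate; tabulate∘lookup; tabulate-cong)
open import Data.Nat.ListAction using (product)
open import Data.List using ([]; _∷_; map; upTo; allFin; filterᵇ)
open import Data.List.Properties using (length-upTo; length-tabulate; length-map; length-removeAt′; length-filter)
open import Data.List.Membership.Propositional using (_∈_; _─_)
open import Data.List.Membership.Propositional.Properties using (∈-upTo⁺; ∈-allFin; ∈-map⁻)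
open import Data.List.Relation.Binary.Subset.Propositional using (_⊆_)
open import Data.List.Relation.Unary.Any as Any using (here; there; index)
open import Data.List.Relation.Unary.Any.Properties using (any⁺)
open import Data.List.Relation.Unary.All as All using ([]; _∷_)
open import Data.List.Relation.Unary.AllPairs using ([]; _∷_)
open import Data.Fin.Properties using () renaming (_≟_ to _≟ᶠ_)
open import Function using (Equivalence; _∘_; id)
open import Relation.Binary.PropositionalEquality hiding (sym)
import Relation.Binary.PropositionalEquality as ≡
open import Relation.Binary.Construct.Closure.ReflexiveTransitive using (Star; ε; _◅_)
open import Relation.Nullary.Decidable using (⌊_⌋; fromWitness; toWitnessFalse)

∈-─ : ∀ {A : Set} {x z} {ys : List A} (x∈ys : x ∈ ys) → z ∈ ys → z ≢ x → z ∈ ys ─ x∈ys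
∈-─ (here refl)  (here refl)  z≢x = ⊥-elim (z≢x refl)
∈-─ (here _)     (there z∈ys) _   = z∈ys
∈-─ (there _)    (here refl)  _   = here refl
∈-─ (there x∈ys) (there z∈ys) z≢x = there (∈-─ x∈ys z∈ys z≢x)

Unique-⊆⇒length≤ : ∀ {A : Set} {xs ys : List A} → Unique xs → xs ⊆ ys → length xs ≤ length ys
Unique-⊆⇒length≤ [] _ = z≤n
Unique-⊆⇒length≤ {xs = x ∷ xs} {ys} (x∉xs ∷ xs!) xs⊆ys = begin
    suc (length xs)            ≤⟨ s≤s (Unique-⊆⇒length≤ xs! xs⊆ys─x) ⟩
    suc (length (ys ─ x∈ys))   ≡⟨ length-removeAt′ ys (index x∈ys) ⟨
    length ys                  ∎
  where
  open ℕ.≤-Reasoning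
  x∈ys : x ∈ ys
  x∈ys = xs⊆ys (here refl)
  xs⊆ys─x : xs ⊆ ys ─ x∈ys
  xs⊆ys─x z∈xs = ∈-─ x∈ys (xs⊆ys (there z∈xs)) (λ z≡x → All.lookup x∉xs z∈xs (≡.sym z≡x))

Unique-map⁺-on : ∀ {A B : Set} {P : A → Set} {f : A → B} →
                 (∀ {x y} → P x → P y → f x ≡ f y → x ≡ y) →
                 ∀ {xs} → All P xs → Unique xs → Unique (map f xs)
Unique-map⁺-on inj [] [] = []
Unique-map⁺-on {P = P} {f} inj {x ∷ xs} (px ∷ pxs) (x∉xs ∷ xs!) =
  fx∉fys pxs x∉xs ∷ Unique-map⁺-on inj pxs xs!
  where
  fx∉fys : ∀ {ys} → All P ys → All (x ≢_) ys → All (f x ≢_) (map f ys)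
  fx∉fys []         []           = []
  fx∉fys (py ∷ pys) (x≢y ∷ x≢ys) = (λ fx≡fy → x≢y (inj px py fx≡fy)) ∷ fx∉fys pys x≢ys

+-*-injective : ∀ {k m m′ q q′} → m < k → m′ < k → m + k * q ≡ m′ + k * q′ → m ≡ m′ × q ≡ q′
+-*-injective {suc r} {m} {m′} {q} {q′} m<k m′<k eq =
  m≡m′ , ℕ.*-cancelˡ-≡ q q′ (suc r) (ℕ.+-cancelˡ-≡ m _ _ (trans eq (cong (_+ suc r * q′) (≡.sym m≡m′))))
  where
  digit : ∀ d t → d < suc r → (d + suc r * t) % suc r ≡ d
  digit d t d<k = begin
    (d + suc r * t) % suc r  ≡⟨ cong (λ x → (d + x) % suc r) (ℕ.*-comm (suc r) t) ⟩
    (d + t * suc r) % suc r  ≡⟨ [m+kn]%n≡m%n d t (suc r) ⟩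
    d % suc r                ≡⟨ m<n⇒m%n≡m d<k ⟩
    d                        ∎
    where open ≡-Reasoning
  m≡m′ : m ≡ m′
  m≡m′ = trans (≡.sym (digit m q m<k)) (trans (cong (_% suc r) eq) (digit m′ q′ m′<k))

module _ {A : Set} (r : A → ℕ) where

  mixedRadix : (A → ℕ) → List A → ℕ
  mixedRadix d []       = 0
  mixedRadix d (x ∷ xs) = d x + r x * mixedRadix d xs

  mixedRadix-< : ∀ {d} xs → All (λ x → d x < r x) xs → mixedRadix d xs < product (map r xs)
  mixedRadix-< []       []           = s≤s z≤n
  mixedRadix-< {d} (x ∷ xs) (dx<rx ∷ ds<rs) = begin-strict
    d x + r x * mixedRadix d xs   <⟨ ℕ.+-monoˡ-< _ dx<rx ⟩
    r x + r x * mixedRadix d xs   ≡⟨ ℕ.*-suc (r x) _ ⟨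
    r x * suc (mixedRadix d xs)   ≤⟨ ℕ.*-monoʳ-≤ (r x) (mixedRadix-< xs ds<rs) ⟩
    r x * product (map r xs)      ∎
    where open ℕ.≤-Reasoning

  mixedRadix-injective : ∀ {d d′} xs → All (λ x → d x < r x) xs → All (λ x → d′ x < r x) xs →
                         mixedRadix d xs ≡ mixedRadix d′ xs → All (λ x → d x ≡ d′ x) xs
  mixedRadix-injective [] [] [] _ = []
  mixedRadix-injective (x ∷ xs) (dx<rx ∷ ds<rs) (d′x<rx ∷ d′s<rs) eq
    with dx≡d′x , rest ← +-*-injective dx<rx d′x<rx eq
    = dx≡d′x ∷ mixedRadix-injective xs ds<rs d′s<rs rest

product-map-∘ : ∀ {A : Set} (f : Bool → ℕ) (p : A → Bool) (xs : List A) →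
                product (map (f ∘ p) xs)
                  ≡ f false ^ (length xs ∸ length (filterᵇ p xs)) * f true ^ length (filterᵇ p xs)
product-map-∘ f p [] = refl
product-map-∘ f p (x ∷ xs) with p x | product-map-∘ f p xs
... | true  | ih = trans (cong (f true *_) ih) (x∙yz≈y∙xz (f true) (f false ^ (m ∸ k)) (f true ^ k))
  where
  m = length xs
  k = length (filterᵇ p xs)
... | false | ih = begin
    f false * product (map (f ∘ p) xs)        ≡⟨ cong (f false *_) ih ⟩
    f false * (f false ^ (m ∸ k) * f true ^ k)  ≡⟨ ℕ.*-assoc (f false) _ _ ⟨
    f false ^ suc (m ∸ k) * f true ^ k          ≡⟨ cong (λ e → f false ^ e * f true ^ k) suc[m∸k]≡suc[m]∸k ⟩
    f false ^ (suc m ∸ k) * f true ^ k          ∎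
  where
  open ≡-Reasoning
  m = length xs
  k = length (filterᵇ p xs)
  suc[m∸k]≡suc[m]∸k : suc (m ∸ k) ≡ suc m ∸ k
  suc[m∸k]≡suc[m]∸k = ≡.sym (ℕ.+-∸-assoc 1 (length-filter (T? ∘ p) xs))

^∸*^≤^ : ∀ {a c} m k → c ≤ a → k ≤ m → c ^ (m ∸ k) * a ^ k ≤ a ^ m
^∸*^≤^ {a} {c} m k c≤a k≤m = begin
  c ^ (m ∸ k) * a ^ k  ≤⟨ ℕ.*-monoˡ-≤ (a ^ k) (ℕ.^-monoˡ-≤ (m ∸ k) c≤a) ⟩
  a ^ (m ∸ k) * a ^ k  ≡⟨ ℕ.^-distribˡ-+-* a (m ∸ k) k ⟨
  a ^ (m ∸ k + k)      ≡⟨ cong (a ^_) (ℕ.m∸n+n≡m k≤m) ⟩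
  a ^ m                ∎
  where open ℕ.≤-Reasoning

+-cancelʳ-≤ : ∀ {i j} k → i ℤ.+ k ℤ.≤ j ℤ.+ k → i ℤ.≤ j
+-cancelʳ-≤ {i} {j} k i+k≤j+k = subst₂ ℤ._≤_ (i+k-k≡i i k) (i+k-k≡i j k) (ℤ.+-monoˡ-≤ (ℤ.- k) i+k≤j+k)
  where
  i+k-k≡i : ∀ i k → i ℤ.+ k ℤ.- k ≡ i
  i+k-k≡i = solve-∀

InBase-first : ∀ {n b i} → i < numBase n b → InBase n b i (suc (i * suc b))
InBase-first {n} {b} {i} i<nb = (s≤s z≤n , p≤n) , lower , upper
  where
  p≤n : suc (i * suc b) ≤ n
  p≤n = ℕ.+-cancelˡ-≤ b _ n (begin
    b + suc (i * suc b)  ≡⟨ ℕ.+-suc b (i * suc b) ⟩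
    suc i * suc b        ≤⟨ ℕ.*-monoˡ-≤ (suc b) i<nb ⟩
    numBase n b * suc b  ≤⟨ m/n*n≤m (n + b) (suc b) ⟩
    n + b                ≡⟨ ℕ.+-comm n b ⟩
    b + n                ∎)
    where open ℕ.≤-Reasoning
  lower : + i ℤ.* + suc b ℤ.+ + 1 ℤ.≤ + suc (i * suc b)
  lower rewrite ≡.sym (ℤ.pos-* i (suc b)) = ℤ.+≤+ (ℕ.≤-reflexive (ℕ.+-comm (i * suc b) 1))
  upper : + suc (i * suc b) ℤ.≤ + suc i ℤ.* + suc b
  upper rewrite ≡.sym (ℤ.pos-* (suc i) (suc b)) = ℤ.+≤+ (s≤s (ℕ.m≤n+m (i * suc b) b))

InSeg-first : ∀ {n b i j k} → InSeg n b j k (suc (i * suc b)) → j ℤ.≤ + i × + i ℤ.< k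
InSeg-first {n} {b} {i} {j} {k} (_ , j[b+1]<p , p≤k[b+1]) = lower , upper
  where
  lower : j ℤ.≤ + i
  lower = ℤ.*-cancelʳ-≤-pos j (+ i) (+ suc b) (+-cancelʳ-≤ (+ 1)
            (subst (λ x → j ℤ.* + suc b ℤ.+ + 1 ℤ.≤ x)
                   (trans (cong +_ (ℕ.+-comm 1 (i * suc b))) (cong (ℤ._+ + 1) (ℤ.pos-* i (suc b))))
                   j[b+1]<p))
  upper : + i ℤ.< k
  upper = ℤ.*-cancelʳ-<-nonNeg (+ suc b)
            (subst (ℤ._< k ℤ.* + suc b) (ℤ.pos-* i (suc b)) (ℤ.suc[i]≤j⇒i<j p≤k[b+1]))

InBase⊆InSeg⇒bounds : ∀ {n b i j k} → i < numBase n b → (∀ p → InBase n b i p → InSeg n b j k p) →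
                      j ℤ.≤ + i × + i ℤ.< k
InBase⊆InSeg⇒bounds i<nb Θi⊆Θjk = InSeg-first (Θi⊆Θjk _ (InBase-first i<nb))

Window : ℤ → ℕ → Maybe ℕ → Set
Window c w nothing  = ⊤
Window c w (just i) = c ℤ.≤ + i × + i ℤ.< c ℤ.+ + w

offset : ℤ → Maybe ℕ → ℕ
offset c nothing  = 0
offset c (just i) = suc ℤ.∣ + i ℤ.- c ∣

+∣i-c∣≡i-c : ∀ {c i} → c ℤ.≤ i → + ℤ.∣ i ℤ.- c ∣ ≡ i ℤ.- c
+∣i-c∣≡i-c c≤i = ℤ.0≤i⇒+∣i∣≡i (ℤ.i≤j⇒0≤j-i c≤i)

offset-< : ∀ {c w} m → Window c w m → offset c m < suc w
offset-< nothing _ = s≤s z≤n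
offset-< {c} {w} (just i) (c≤i , i<c+w) = s≤s (ℤ.drop‿+<+ (begin-strict
  + ℤ.∣ + i ℤ.- c ∣    ≡⟨ +∣i-c∣≡i-c c≤i ⟩
  + i ℤ.- c            <⟨ ℤ.+-monoˡ-< (ℤ.- c) i<c+w ⟩
  c ℤ.+ + w ℤ.- c      ≡⟨ c+w-c≡w c (+ w) ⟩
  + w                  ∎))
  where
  open ℤ.≤-Reasoning
  c+w-c≡w : ∀ c w → c ℤ.+ w ℤ.- c ≡ w
  c+w-c≡w = solve-∀

offset-injective : ∀ {c w w′} m m′ → Window c w m → Window c w′ m′ → offset c m ≡ offset c m′ → m ≡ m′
offset-injective nothing  nothing  _ _ _ = refl
offset-injective {c} (just i) (just j) (c≤i , _) (c≤j , _) eq =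
  cong just (ℤ.+-injective (begin
    + i                ≡⟨ i-c+c≡i (+ i) c ⟨
    + i ℤ.- c ℤ.+ c    ≡⟨ cong (ℤ._+ c) i-c≡j-c ⟩
    + j ℤ.- c ℤ.+ c    ≡⟨ i-c+c≡i (+ j) c ⟩
    + j                ∎))
  where
  open ≡-Reasoning
  i-c+c≡i : ∀ i c → i ℤ.- c ℤ.+ c ≡ i
  i-c+c≡i = solve-∀
  i-c≡j-c : + i ℤ.- c ≡ + j ℤ.- c
  i-c≡j-c = trans (≡.sym (+∣i-c∣≡i-c c≤i)) (trans (cong +_ (ℕ.suc-injective eq)) (+∣i-c∣≡i-c c≤j))

-- The offsets of a leaf are measured from the lowest index its parent allows.
leafAnchor : ℤ → Maybe ℕ → ℤ
leafAnchor ιu nothing  = ιu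
leafAnchor ιu (just k) = + k ℤ.- + 1

∣m⊖n∣≤1⇒ : ∀ m n → ℤ.∣ m ⊖ n ∣ ≤ 1 → m ≤ suc n × n ≤ suc m
∣m⊖n∣≤1⇒ zero          zero          _ = z≤n , z≤n
∣m⊖n∣≤1⇒ zero          (suc zero)    _ = z≤n , s≤s z≤n
∣m⊖n∣≤1⇒ zero          (suc (suc n)) (s≤s ())
∣m⊖n∣≤1⇒ (suc zero)    zero          _ = s≤s z≤n , z≤n
∣m⊖n∣≤1⇒ (suc (suc m)) zero          (s≤s ())
∣m⊖n∣≤1⇒ (suc m)       (suc n)       d≤1
  with m≤1+n , n≤1+m ← ∣m⊖n∣≤1⇒ m n (subst (λ d → ℤ.∣ d ∣ ≤ 1) (ℤ.[1+m]⊖[1+n]≡m⊖n m n) d≤1)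
  = s≤s m≤1+n , s≤s n≤1+m

leafAnchor-window : ∀ {ιu ιv} mu i → ιv ≡ ιu ℤ.- + 1 → + i ℤ.< ιv ℤ.+ + 4 →
                    EdgeOK ιv ιu (just i) mu → Window (leafAnchor ιu mu) 3 (just i)
leafAnchor-window {ιu} nothing i refl i<ιv+4 ιu≤i =
  ιu≤i , subst (+ i ℤ.<_) (ℤ.+-assoc ιu (ℤ.- + 1) (+ 4)) i<ιv+4
leafAnchor-window (just k) i _ _ d≤1 =
  window k (∣m⊖n∣≤1⇒ k i (subst (λ d → ℤ.∣ d ∣ ≤ 1) (ℤ.[+m]-[+n]≡m⊖n k i) d≤1))
  where
  window : ∀ k → k ≤ suc i × i ≤ suc k → Window (+ k ℤ.- + 1) 3 (just i)
  window zero    (_ , i≤1)         = ℤ.-≤+ , ℤ.+<+ (s≤s i≤1)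
  window (suc k) (s≤s k≤i , i≤2+k) = ℤ.+≤+ k≤i , ℤ.+<+ (subst (suc i ≤_) (ℕ.+-comm 3 k) (s≤s i≤2+k))

length-allFin : ∀ n → length (allFin n) ≡ n
length-allFin n = length-tabulate id

module _ {n} {G : Graph n} (D : RootedSpanningTree G) where

  numLeaves≤n : numLeaves D ≤ n
  numLeaves≤n = subst (numLeaves D ≤_) (length-allFin n) (length-filter (T? ∘ isLeaf D) (allFin n))

  leaf⇒not-root : ∀ {v} → T (isLeaf D v) → T (not ⌊ v ≟ᶠ root D ⌋)
  leaf⇒not-root {v} = proj₁ ∘ Equivalence.to (T-∧ {not ⌊ v ≟ᶠ root D ⌋})

  leaf⇒≢root : ∀ {v} → T (isLeaf D v) → v ≢ root D
  leaf⇒≢root = toWitnessFalse ∘ leaf⇒not-root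

  parent-of-leaf-is-inner : ∀ {v} → T (isLeaf D v) → isLeaf D (parent D v) ≡ false
  parent-of-leaf-is-inner {v} leaf =
    trans (cong (λ c → not ⌊ parent D v ≟ᶠ root D ⌋ ∧ not c) (Equivalence.to T-≡ has-child)) (∧-zeroʳ _)
    where
    v-child : T (isChildOf D v (parent D v))
    v-child = Equivalence.from T-∧ (leaf⇒not-root leaf , fromWitness refl)
    has-child : T (any (λ u → isChildOf D u (parent D v)) (allFin n))
    has-child = any⁺ _ (Any.map (λ { refl → v-child }) (∈-allFin v))

module Encoding (b : ℕ) {n} {G : Graph n} {D : RootedSpanningTree G} {ι : Fin n → ℤ}
                (φ : SegmentAssignment b G D ι) where

  record Admissible (s : PState n) : Set where
    constructor admissible
    field
      candidate : StateCandidate b D ι s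
      edges     : ∀ u v → Adj G u v → EdgeOK (ι u) (ι v) (lookup s u) (lookup s v)

  emptyState-admissible : Admissible (emptyState n)
  emptyState-admissible = admissible no-segment no-edge
    where
    no-segment : StateCandidate b D ι (emptyState n)
    no-segment v i sv≡i with () ← trans (≡.sym (lookup-replicate v nothing)) sv≡i
    no-edge : ∀ u v → Adj G u v → EdgeOK (ι u) (ι v) (lookup (emptyState n) u) (lookup (emptyState n) v)
    no-edge u v _ rewrite lookup-replicate u (nothing {A = ℕ}) | lookup-replicate v (nothing {A = ℕ}) = tt

  Step⇒Admissible : ∀ {s t} → Step b G D ι s t → Admissible t
  Step⇒Admissible (_ , (_ , (candidate , _ , edges) , _) , _) = admissible candidate edges

  Star-admissible : ∀ {s t} → Star (Step b G D ι) s t → Admissible s → Admissible t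
  Star-admissible ε                  adm = adm
  Star-admissible {s} (step ◅ steps) _ = Star-admissible steps (Step⇒Admissible {s} step)

  Reachable⇒Admissible : ∀ {s} → Reachable b G D ι s → Admissible s
  Reachable⇒Admissible reach = Star-admissible reach emptyState-admissible

  within-φ : ∀ {s v i} → StateCandidate b D ι s → lookup s v ≡ just i →
             ι v ℤ.≤ + i × + i ℤ.< ι v ℤ.+ width D v
  within-φ {s} sc sv≡i = InBase⊆InSeg⇒bounds (proj₁ (sc _ _ sv≡i)) (proj₂ (sc _ _ sv≡i))

  inner-window : ∀ {s v} → Admissible s → isLeaf D v ≡ false → Window (ι v) 2 (lookup s v)
  inner-window {s} {v} (admissible sc _) inner with lookup s v in sv≡i
  ... | nothing = tt
  ... | just i with ιv≤i , i<ιv+w ← within-φ {s} sc sv≡i =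
    ιv≤i , subst (λ w → + i ℤ.< ι v ℤ.+ w) (cong (λ l → if l then + 4 else + 2) inner) i<ιv+w

  leaf-window : ∀ {s v} → Admissible s → T (isLeaf D v) →
                Window (leafAnchor (ι (parent D v)) (lookup s (parent D v))) 3 (lookup s v)
  leaf-window {s} {v} (admissible sc edges) leaf
    with lookup s v in sv≡i | edges v (parent D v) (parent-adj D v (leaf⇒≢root D leaf))
  ... | nothing | _    = tt
  ... | just i  | edge =
    leafAnchor-window (lookup s (parent D v)) i (SegmentAssignment.leaf-step φ v leaf)
      (subst (λ w → + i ℤ.< ι v ℤ.+ w) (cong (λ l → if l then + 4 else + 2) (Equivalence.to T-≡ leaf))
             (proj₂ (within-φ {s} sc sv≡i)))
      edge

  windowWidth : Bool → ℕ
  windowWidth true  = 3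
  windowWidth false = 2

  anchorAt : Bool → PState n → Fin n → ℤ
  anchorAt true  s v = leafAnchor (ι (parent D v)) (lookup s (parent D v))
  anchorAt false s v = ι v

  anchor : PState n → Fin n → ℤ
  anchor s v = anchorAt (isLeaf D v) s v

  window : ∀ {s} → Admissible s → ∀ v →
           Window (anchorAt (isLeaf D v) s v) (windowWidth (isLeaf D v)) (lookup s v)
  window adm v with isLeaf D v in leaf
  ... | true  = leaf-window adm (Equivalence.from T-≡ leaf)
  ... | false = inner-window adm leaf

  radix : Fin n → ℕ
  radix v = suc (windowWidth (isLeaf D v))

  digit : PState n → Fin n → ℕ
  digit s v = offset (anchor s v) (lookup s v)

  digit-< : ∀ {s} → Admissible s → ∀ v → digit s v < radix v
  digit-< {s} adm v = offset-< (lookup s v) (window adm v)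

  digits-injective : ∀ {s t} → Admissible s → Admissible t → (∀ v → digit s v ≡ digit t v) → s ≡ t
  digits-injective {s} {t} adm-s adm-t digits≡ =
    trans (≡.sym (tabulate∘lookup s)) (trans (tabulate-cong agree) (tabulate∘lookup t))
    where
    agree-at : ∀ v → anchor s v ≡ anchor t v → lookup s v ≡ lookup t v
    agree-at v anchors≡ =
      offset-injective (lookup s v) (lookup t v) (window adm-s v)
        (subst (λ c → Window c _ (lookup t v)) (≡.sym anchors≡) (window adm-t v))
        (trans (digits≡ v) (cong (λ c → offset c (lookup t v)) (≡.sym anchors≡)))
    anchor-inner : ∀ {u} w → isLeaf D u ≡ false → anchor w u ≡ ι u
    anchor-inner {u} w inner = cong (λ l → anchorAt l w u) inner
    anchor-leaf : ∀ {u} w → isLeaf D u ≡ true → anchor w u ≡ leafAnchor (ι (parent D u)) (lookup w (parent D u))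
    anchor-leaf {u} w leaf = cong (λ l → anchorAt l w u) leaf
    agree-inner : ∀ u → isLeaf D u ≡ false → lookup s u ≡ lookup t u
    agree-inner u inner = agree-at u (trans (anchor-inner s inner) (≡.sym (anchor-inner t inner)))
    agree : ∀ v → lookup s v ≡ lookup t v
    agree v with isLeaf D v in leaf
    ... | false = agree-inner v leaf
    ... | true  = agree-at v (begin
      anchor s v                                             ≡⟨ anchor-leaf s leaf ⟩
      leafAnchor (ι (parent D v)) (lookup s (parent D v))    ≡⟨ cong (leafAnchor _) parents≡ ⟩
      leafAnchor (ι (parent D v)) (lookup t (parent D v))    ≡⟨ anchor-leaf t leaf ⟨
      anchor t v                                             ∎)
      where
      open ≡-Reasoning
      parents≡ : lookup s (parent D v) ≡ lookup t (parent D v)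
      parents≡ = agree-inner (parent D v) (parent-of-leaf-is-inner D (Equivalence.from T-≡ leaf))

  encode : PState n → ℕ
  encode s = mixedRadix radix (digit s) (allFin n)

  digits-< : ∀ {s} → Admissible s → All (λ v → digit s v < radix v) (allFin n)
  digits-< adm = All.tabulate (λ {v} _ → digit-< adm v)

  encode-< : ∀ {s} → Admissible s → encode s < product (map radix (allFin n))
  encode-< adm = mixedRadix-< radix (allFin n) (digits-< adm)

  encode-injective : ∀ {s t} → Admissible s → Admissible t → encode s ≡ encode t → s ≡ t
  encode-injective adm-s adm-t eq = digits-injective adm-s adm-t λ v →
    All.lookup (mixedRadix-injective radix (allFin n) (digits-< adm-s) (digits-< adm-t) eq) (∈-allFin v)

  reachable-states-count : ∀ {visited} → Unique visited → All (Reachable b G D ι) visited →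
                           length visited ≤ product (map radix (allFin n))
  reachable-states-count {visited} visited! reachable = begin
    length visited               ≡⟨ length-map encode visited ⟨
    length (map encode visited)  ≤⟨ Unique-⊆⇒length≤ codes! codes⊆upTo-M ⟩
    length (upTo M)              ≡⟨ length-upTo M ⟩
    M                            ∎
    where
    open ℕ.≤-Reasoning
    M = product (map radix (allFin n))
    visited-admissible : All Admissible visited
    visited-admissible = All.map Reachable⇒Admissible reachable
    codes! : Unique (map encode visited)
    codes! = Unique-map⁺-on encode-injective visited-admissible visited!
    codes⊆upTo-M : map encode visited ⊆ upTo M
    codes⊆upTo-M c∈codes with s , s∈visited , refl ← ∈-map⁻ encode c∈codes =
      ∈-upTo⁺ (encode-< (All.lookup visited-admissible s∈visited))

  product-radix : product (map radix (allFin n)) ≡ 3 ^ (n ∸ numLeaves D) * 4 ^ numLeaves D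
  product-radix = subst (λ m → product (map radix (allFin n)) ≡ 3 ^ (m ∸ numLeaves D) * 4 ^ numLeaves D)
                    (length-allFin n) (product-map-∘ (suc ∘ windowWidth) (isLeaf D) (allFin n))

lemma6 : (n b : ℕ) (G : Graph n) → Connected G → 2 ≤ n → 1 ≤ b → b < n →
         (D : RootedSpanningTree G) → (ι : Fin n → ℤ) → SegmentAssignment b G D ι →
         (visited : List (PState n)) → Unique visited → All (Reachable b G D ι) visited →
         (length visited ≤ 3 ^ (n ∸ numLeaves D) * 4 ^ numLeaves D)
         × (3 ^ (n ∸ numLeaves D) * 4 ^ numLeaves D ≤ 4 ^ n)
lemma6 n b G _ _ _ _ D ι φ visited visited! reachable =
  subst (length visited ≤_) product-radix (reachable-states-count visited! reachable) ,
  ^∸*^≤^ n (numLeaves D) (ℕ.n≤1+n 3) (numLeaves≤n D)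
  where open Encoding b φ
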